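{- Let $f$ be an $n$-ary operation on a set $A$ and let $0\le k\le n$. If $f$ is a $k$-WNU, then $t_0^{f}$ is a $k$-WNU.
   Context: An $n$-ary operation $g$ is a $k$-WNU if it is symmetric on $(\underbrace{x,\dots,x}_{k},y,\dots,y)$, i.e. $g$ takes the same value on all tuples in $\{c,d\}^n$ with exactly $k$ entries equal to $c$, for all $c,d$. For an $n$-ary $f$ define operations $t_\ell^f$ for $\ell=n,n-1,\dots,0$ (with $t_\ell^f$ of arity $\ell+n$): $t_n^f(x_1,\dots,x_n,y_1,\dots,y_n)=f(x_1,\dots,x_n)$, and for $\ell<n$, $t_\ell^f(x_1,\dots,x_\ell,y_1,\dots,y_n)=f\big(t_{\ell+1}^f(x_1,\dots,x_\ell,y_1,y_1,\dots,y_n),\,t_{\ell+1}^f(x_1,\dots,x_\ell,y_2,y_1,\dots,y_n),\dots,t_{\ell+1}^f(x_1,\dots,x_\ell,y_n,y_1,\dots,y_n)\big)$. Thus $t_0^f$ is an $n$-ary operation in $y_1,\dots,y_n$. -}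

module Defs where

open import Data.Nat using (ℕ; zero; suc; _+_)
open import Data.Nat.Properties using (+-identityʳ; +-suc)
open import Data.Bool using (Bool; if_then_else_)
open import Data.Vec using (Vec; _∷ʳ_; cast; map; tabulate)
open import Data.Fin.Subset using (Subset; ∣_∣)
open import Relation.Binary.PropositionalEquality using (_≡_; refl; sym; trans)

Op : Set → ℕ → Set
Op A n = Vec A n → A

twoValued : {A : Set} {n : ℕ} → A → A → Subset n → Vec A n
twoValued c d S = map (λ b → if b then c else d) S

IsWNU : {A : Set} {n : ℕ} → ℕ → Op A n → Set
IsWNU {A} {n} k g =
  (c d : A) (S T : Subset n) → ∣ S ∣ ≡ k → ∣ T ∣ ≡ k →
  g (twoValued c d S) ≡ g (twoValued c d T)

-- tAux f m ℓ _ x y = t_ℓ^f(x_1..x_ℓ, y_1..y_n), where m = n - ℓ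
-- (recursion on m, i.e. from ℓ = n down to ℓ = 0).
tAux : {A : Set} {n : ℕ} → Op A n →
       (m ℓ : ℕ) → ℓ + m ≡ n → Vec A ℓ → Vec A n → A
tAux f zero ℓ eq x y = f (cast (trans (sym (+-identityʳ ℓ)) eq) x)
tAux {n = n} f (suc m) ℓ eq x y =
  f (tabulate (λ i → tAux f m (suc ℓ) (trans (sym (+-suc ℓ m)) eq)
                        (x ∷ʳ Data.Vec.lookup y i) y))

t0 : {A : Set} {n : ℕ} → Op A n → Op A n
t0 {n = n} f y = tAux f n 0 refl Data.Vec.[] y

{-# OPTIONS --safe #-}
-- At every level of the recursion defining t_0^f, the i-th argument of the outer f depends on the
-- input y only through y_i (and the whole, shared tuple y). So on a two-valued input y = (c,d)_S
-- the outer f receives the two-valued tuple (g c, g d)_S with the same c-positions S, where g is the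
-- next level of the recursion. By induction on the depth, g is the same function for all inputs
-- (c,d)_S with |S| = k, and then the k-WNU identity of f finishes the step.
module Submission where

open import Defs
open import Data.Nat using (ℕ; _≤_; zero; suc; _+_)
open import Data.Nat.Properties using (+-suc)
open import Data.Bool using (true; false)
open import Data.Vec using (Vec; []; _∷_; _∷ʳ_; map; tabulate; lookup)
open import Data.Vec.Properties using (tabulate-∘; tabulate∘lookup)
open import Data.Fin.Subset using (Subset; ∣_∣)
open import Function using (_∘_)
open import Relation.Binary.PropositionalEquality
  using (_≡_; refl; sym; trans; cong; cong₂; module ≡-Reasoning)

map-twoValued : {A B : Set} {n : ℕ} (h : A → B) (c d : A) (S : Subset n) →
  map h (twoValued c d S) ≡ twoValued (h c) (h d) S
map-twoValued h c d []          = refl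
map-twoValued h c d (true ∷ S)  = cong (h c ∷_) (map-twoValued h c d S)
map-twoValued h c d (false ∷ S) = cong (h d ∷_) (map-twoValued h c d S)

tabulate-lookup-twoValued : {A B : Set} {n : ℕ} (h : A → B) (c d : A) (S : Subset n) →
  tabulate (h ∘ lookup (twoValued c d S)) ≡ twoValued (h c) (h d) S
tabulate-lookup-twoValued h c d S = begin
  tabulate (h ∘ lookup (twoValued c d S))     ≡⟨ tabulate-∘ h (lookup (twoValued c d S)) ⟩
  map h (tabulate (lookup (twoValued c d S))) ≡⟨ cong (map h) (tabulate∘lookup (twoValued c d S)) ⟩
  map h (twoValued c d S)                     ≡⟨ map-twoValued h c d S ⟩
  twoValued (h c) (h d) S                     ∎
  where open ≡-Reasoning

module _ {A : Set} {n : ℕ} (f : Op A n) where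

  tAux-inner : (m ℓ : ℕ) → ℓ + suc m ≡ n → Vec A ℓ → Vec A n → A → A
  tAux-inner m ℓ eq x y a = tAux f m (suc ℓ) (trans (sym (+-suc ℓ m)) eq) (x ∷ʳ a) y

  tAux-twoValued-suc : (c d : A) (S : Subset n) (m ℓ : ℕ) (eq : ℓ + suc m ≡ n) (x : Vec A ℓ) →
    let inner = tAux-inner m ℓ eq x (twoValued c d S)
    in tAux f (suc m) ℓ eq x (twoValued c d S) ≡ f (twoValued (inner c) (inner d) S)
  tAux-twoValued-suc c d S m ℓ eq x =
    cong f (tabulate-lookup-twoValued (tAux-inner m ℓ eq x (twoValued c d S)) c d S)

  module _ {k : ℕ} (f-wnu : IsWNU k f) where

    tAux-twoValued-invariant : (c d : A) (S T : Subset n) → ∣ S ∣ ≡ k → ∣ T ∣ ≡ k →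
      (m ℓ : ℕ) (eq : ℓ + m ≡ n) (x : Vec A ℓ) →
      tAux f m ℓ eq x (twoValued c d S) ≡ tAux f m ℓ eq x (twoValued c d T)
    tAux-twoValued-invariant c d S T ∣S∣≡k ∣T∣≡k zero    ℓ eq x = refl
    tAux-twoValued-invariant c d S T ∣S∣≡k ∣T∣≡k (suc m) ℓ eq x = begin
      tAux f (suc m) ℓ eq x (twoValued c d S)  ≡⟨ tAux-twoValued-suc c d S m ℓ eq x ⟩
      f (twoValued (inner S c) (inner S d) S)  ≡⟨ cong f (cong₂ (λ a b → twoValued a b S)
                                                    (inner-invariant c) (inner-invariant d)) ⟩
      f (twoValued (inner T c) (inner T d) S)  ≡⟨ f-wnu (inner T c) (inner T d) S T ∣S∣≡k ∣T∣≡k ⟩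
      f (twoValued (inner T c) (inner T d) T)  ≡⟨ tAux-twoValued-suc c d T m ℓ eq x ⟨
      tAux f (suc m) ℓ eq x (twoValued c d T)  ∎
      where
      open ≡-Reasoning
      inner : Subset n → A → A
      inner U = tAux-inner m ℓ eq x (twoValued c d U)
      inner-invariant : (a : A) → inner S a ≡ inner T a
      inner-invariant a = tAux-twoValued-invariant c d S T ∣S∣≡k ∣T∣≡k m (suc ℓ) _ (x ∷ʳ a)

lemma4p9 : (A : Set) (n k : ℕ) (f : Op A n) → k ≤ n →
    IsWNU k f → IsWNU k (t0 f)
lemma4p9 A n k f _ f-wnu c d S T ∣S∣≡k ∣T∣≡k =
  tAux-twoValued-invariant f f-wnu c d S T ∣S∣≡k ∣T∣≡k n 0 refl []
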